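{- Let $\{G_n(x)\}$ be a generalized Fibonacci polynomial sequence of either Lucas type or Fibonacci type. Then: (1) $\gcd(d(x),G_{2n+1}(x))=G_1(x)$ for every positive integer $n$; (2) if the sequence is of Lucas type then $\gcd(d(x),G_{2n}(x))=1$, and if it is of Fibonacci type then $\gcd(d(x),G_{2n}(x))=d(x)$, for every positive integer $n$; (3) $\gcd(g(x),G_n(x))=\gcd(g(x),G_1(x))=1$ for every positive integer $n$.
   Context: All polynomials lie in $\mathbb{Z}[x]$ and $\gcd$ denotes the greatest common divisor in $\mathbb{Z}[x]$ (determined up to sign). A generalized Fibonacci polynomial (GFP) sequence $\{G_n(x)\}_{n\ge0}$ is given by $G_0(x)=p_0(x)$, $G_1(x)=p_1(x)$ and $G_n(x)=d(x)G_{n-1}(x)+g(x)G_{n-2}(x)$ for $n\ge 2$, where $p_0(x)$ is a constant and $p_1(x),d(x),g(x)$ are nonzero polynomials in $\mathbb{Z}[x]$ with $\gcd(d(x),g(x))=1$; as in the paper it is assumed that $d(x)^2+4g(x)>0$. Let $a,b$ be the roots of $z^2-d(x)z-g(x)=0$. The sequence is of Lucas type if $p_0\ne 0$, $2p_1(x)=p_0\,d(x)$, $|p_0|\in\{1,2\}$, and $\gcd(p_0,p_1(x))=\gcd(p_0,d(x))=\gcd(p_0,g(x))=1$; then, with $\alpha=2/p_0$, $G_n=(a^n+b^n)/\alpha$. It is of Fibonacci type if $p_0=0$ and $p_1=1$; then $G_n=(a^n-b^n)/(a-b)$. -}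

module Defs where

open import Data.Nat using (ℕ; zero; suc)
open import Data.Integer as ℤ using (ℤ; +_; 0ℤ; 1ℤ; ∣_∣)
open import Data.Rational as ℚ using (ℚ; _/_)
open import Data.List using (List; []; _∷_; map)
open import Data.List.Relation.Unary.All using (All)
open import Data.Product using (Σ; _×_)
open import Data.Sum using (_⊎_)
open import Relation.Binary.PropositionalEquality using (_≡_)
open import Relation.Nullary using (¬_)

-- Polynomials in ℤ[x] as coefficient lists, lowest degree first.
-- Trailing zeros are allowed; equality of polynomials is _≈_ below.
Poly : Set
Poly = List ℤ

const : ℤ → Poly
const c = c ∷ []

one : Poly
one = const 1ℤ

infixl 6 _+ₚ_ _-ₚ_
infixl 7 _*ₚ_

_+ₚ_ : Poly → Poly → Poly
[] +ₚ q = q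
(a ∷ p) +ₚ [] = a ∷ p
(a ∷ p) +ₚ (b ∷ q) = (a ℤ.+ b) ∷ (p +ₚ q)

negₚ : Poly → Poly
negₚ = map (λ c → ℤ.- c)

_-ₚ_ : Poly → Poly → Poly
p -ₚ q = p +ₚ negₚ q

_*ₚ_ : Poly → Poly → Poly
[] *ₚ q = []
(a ∷ p) *ₚ q = map (a ℤ.*_) q +ₚ (0ℤ ∷ (p *ₚ q))

IsZero : Poly → Set
IsZero p = All (λ c → c ≡ 0ℤ) p

infix 4 _≈_ _∣ₚ_
_≈_ : Poly → Poly → Set
p ≈ q = IsZero (p -ₚ q)

_∣ₚ_ : Poly → Poly → Set
p ∣ₚ q = Σ Poly (λ r → r *ₚ p ≈ q)

-- h is a greatest common divisor of p and q in ℤ[x]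
-- (gcd is determined up to sign, i.e. up to units of ℤ[x];
--  "gcd(p,q) = h" means h is one of the gcds)
IsGCD : Poly → Poly → Poly → Set
IsGCD h p q = (h ∣ₚ p) × (h ∣ₚ q) × (∀ c → c ∣ₚ p → c ∣ₚ q → c ∣ₚ h)

eval : Poly → ℚ → ℚ
eval [] x = ℚ.0ℚ
eval (c ∷ p) x = (c / 1) ℚ.+ x ℚ.* eval p x

G : ℤ → Poly → Poly → Poly → ℕ → Poly
G p0 p1 d g zero = const p0
G p0 p1 d g (suc zero) = p1
G p0 p1 d g (suc (suc n)) = d *ₚ G p0 p1 d g (suc n) +ₚ g *ₚ G p0 p1 d g n

IsGFP : ℤ → Poly → Poly → Poly → Set
IsGFP p0 p1 d g =
  ¬ IsZero p1 × ¬ IsZero d × ¬ IsZero g × IsGCD one d g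
  × (∀ (x : ℚ) → ℚ.0ℚ ℚ.< eval (d *ₚ d +ₚ const (+ 4) *ₚ g) x)

LucasType : ℤ → Poly → Poly → Poly → Set
LucasType p0 p1 d g =
  ¬ (p0 ≡ 0ℤ)
  × (const (+ 2) *ₚ p1 ≈ const p0 *ₚ d)
  × (∣ p0 ∣ ≡ 1 ⊎ ∣ p0 ∣ ≡ 2)
  × IsGCD one (const p0) p1 × IsGCD one (const p0) d × IsGCD one (const p0) g

FibonacciType : ℤ → Poly → Set
FibonacciType p0 p1 = (p0 ≡ 0ℤ) × (p1 ≈ one)

{-# OPTIONS --safe #-}
module Submission where

-- Modulo d the recurrence reads G (n + 2) ≡ g · G n with g coprime to d, so coprimality
-- with d, or divisibility by d, propagates from G 0 = p0 and G 1 = p1 along each parity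
-- class; likewise gcd(g, G (n + 2)) = gcd(g, d · G (n + 1)). The delicate case is Lucas type
-- with |p0| = 1, where d = ±2 p1: then G (2n + 1) = p1 · H with 2 ∤ H (as 2 ∤ g), and
-- gcd(2 p1, p1 H) = p1.
-- The arithmetic of ℤ[x] used ("coprime to b and to c implies coprime to b c") comes from
-- Euclid's algorithm over ℚ, made integral by pseudo-division, which yields u a + v b = N ≠ 0,
-- together with Gauss's lemma to rule out the prime factors of N.

open import Defs
open import Data.Nat using (ℕ; _≤_; _*_; _+_)
open import Data.Product using (_×_)
open import Data.Sum using (_⊎_)
open import Data.Integer using (ℤ)

open import Data.Nat as ℕ using (zero; suc; z≤n; s≤s)
import Data.Nat.Properties as ℕ
import Data.Nat.Divisibility as ℕ∣
open import Data.Nat.ListAction using (product)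
open import Data.Nat.Primality using (Prime; euclidsLemma; prime⇒nonZero; ¬prime[0]; ¬prime[1]; prime[2])
open import Data.Nat.Primality.Factorisation using (factorise; PrimeFactorisation)
open import Data.Integer as ℤ using (+_; 0ℤ; 1ℤ; -[1+_])
import Data.Integer.Properties as ℤ
open import Data.Integer.Divisibility.Signed as ℤ∣ using (divides) renaming (_∣_ to _∣ℤ_)
open import Data.Integer.Tactic.RingSolver using () renaming (solve-∀ to ℤ-solve-∀)
open import Data.List using (List; []; _∷_; map; length)
open import Data.List.Relation.Unary.All using (All; []; _∷_)
open import Data.Maybe using (Maybe; just; nothing)
open import Data.Product using (Σ; _,_; proj₂; uncurry)
open import Data.Sum as Sum using (inj₁; inj₂; [_,_]′)
open import Data.Empty using (⊥-elim)
open import Function using (_∘_)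
open import Relation.Nullary using (¬_; Dec; yes; no)
open import Relation.Nullary.Decidable using (decidable-stable; map′)
open import Relation.Binary.PropositionalEquality
import Relation.Binary.Reasoning.Setoid
open import Algebra.Bundles using (CommutativeRing)
open import Tactic.RingSolver.Core.AlmostCommutativeRing using (fromCommutativeRing)

coeff : Poly → ℕ → ℤ
coeff [] i = 0ℤ
coeff (c ∷ p) zero = c
coeff (c ∷ p) (suc i) = coeff p i

-- Agrees with _≈_ (see ≈⇒≐ and ≐⇒≈) but, being a record, lets its arguments be inferred.
infix 4 _≐_
record _≐_ (p q : Poly) : Set where
  constructor mk≐
  field at : ∀ i → coeff p i ≡ coeff q i
open _≐_ public

≐-refl : ∀ {p} → p ≐ p
≐-refl = mk≐ λ i → refl

≐-sym : ∀ {p q} → p ≐ q → q ≐ p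
≐-sym e = mk≐ λ i → sym (at e i)

≐-trans : ∀ {p q r} → p ≐ q → q ≐ r → p ≐ r
≐-trans e f = mk≐ λ i → trans (at e i) (at f i)

coeff-+ : ∀ p q i → coeff (p +ₚ q) i ≡ coeff p i ℤ.+ coeff q i
coeff-+ [] q i = sym (ℤ.+-identityˡ _)
coeff-+ (a ∷ p) [] i = sym (ℤ.+-identityʳ _)
coeff-+ (a ∷ p) (b ∷ q) zero = refl
coeff-+ (a ∷ p) (b ∷ q) (suc i) = coeff-+ p q i

coeff-map : ∀ (f : ℤ → ℤ) → f 0ℤ ≡ 0ℤ → ∀ p i → coeff (map f p) i ≡ f (coeff p i)
coeff-map f f0 [] i = sym f0
coeff-map f f0 (c ∷ p) zero = refl
coeff-map f f0 (c ∷ p) (suc i) = coeff-map f f0 p i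

coeff-neg : ∀ p i → coeff (negₚ p) i ≡ ℤ.- coeff p i
coeff-neg = coeff-map ℤ.-_ refl

coeff-scale : ∀ a p i → coeff (map (a ℤ.*_) p) i ≡ a ℤ.* coeff p i
coeff-scale a = coeff-map (a ℤ.*_) (ℤ.*-zeroʳ a)

coeff-- : ∀ p q i → coeff (p -ₚ q) i ≡ coeff p i ℤ.- coeff q i
coeff-- p q i = trans (coeff-+ p (negₚ q) i) (cong (λ x → coeff p i ℤ.+ x) (coeff-neg q i))

≈⇒≐ : ∀ {p q} → p ≈ q → p ≐ q
≈⇒≐ {p} {q} z = mk≐ λ i → ℤ.i-j≡0⇒i≡j _ _ (trans (sym (coeff-- p q i)) (coeff-IsZero z i))
  where
  coeff-IsZero : ∀ {r} → IsZero r → ∀ i → coeff r i ≡ 0ℤ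
  coeff-IsZero [] i = refl
  coeff-IsZero (c≡0 ∷ z) zero = c≡0
  coeff-IsZero (c≡0 ∷ z) (suc i) = coeff-IsZero z i

≐⇒≈ : ∀ {p q} → p ≐ q → p ≈ q
≐⇒≈ {p} {q} e = IsZero-coeff (p -ₚ q) λ i →
  trans (coeff-- p q i) (trans (cong (ℤ._- coeff q i) (at e i)) (ℤ.+-inverseʳ (coeff q i)))
  where
  IsZero-coeff : ∀ r → (∀ i → coeff r i ≡ 0ℤ) → IsZero r
  IsZero-coeff [] z = []
  IsZero-coeff (c ∷ r) z = z 0 ∷ IsZero-coeff r (λ i → z (suc i))

coeff-*-zero : ∀ a p q → coeff ((a ∷ p) *ₚ q) 0 ≡ a ℤ.* coeff q 0
coeff-*-zero a p q = trans (coeff-+ (map (a ℤ.*_) q) (0ℤ ∷ (p *ₚ q)) 0)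
  (trans (ℤ.+-identityʳ _) (coeff-scale a q 0))

coeff-*-suc : ∀ a p q i → coeff ((a ∷ p) *ₚ q) (suc i) ≡ a ℤ.* coeff q (suc i) ℤ.+ coeff (p *ₚ q) i
coeff-*-suc a p q i = trans (coeff-+ (map (a ℤ.*_) q) (0ℤ ∷ (p *ₚ q)) (suc i))
  (cong (ℤ._+ coeff (p *ₚ q) i) (coeff-scale a q (suc i)))

+-cong : ∀ {p p' q q'} → p ≐ p' → q ≐ q' → p +ₚ q ≐ p' +ₚ q'
+-cong {p} {p'} {q} {q'} e f = mk≐ λ i →
  trans (coeff-+ p q i) (trans (cong₂ ℤ._+_ (at e i) (at f i)) (sym (coeff-+ p' q' i)))

+-comm : ∀ p q → p +ₚ q ≐ q +ₚ p
+-comm p q = mk≐ λ i →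
  trans (coeff-+ p q i) (trans (ℤ.+-comm (coeff p i) (coeff q i)) (sym (coeff-+ q p i)))

+-assoc : ∀ p q r → (p +ₚ q) +ₚ r ≐ p +ₚ (q +ₚ r)
+-assoc p q r = mk≐ λ i → begin
  coeff ((p +ₚ q) +ₚ r) i               ≡⟨ coeff-+ (p +ₚ q) r i ⟩
  coeff (p +ₚ q) i ℤ.+ coeff r i        ≡⟨ cong (ℤ._+ coeff r i) (coeff-+ p q i) ⟩
  coeff p i ℤ.+ coeff q i ℤ.+ coeff r i ≡⟨ ℤ.+-assoc (coeff p i) (coeff q i) (coeff r i) ⟩
  coeff p i ℤ.+ (coeff q i ℤ.+ coeff r i) ≡⟨ cong (λ x → coeff p i ℤ.+ x) (coeff-+ q r i) ⟨
  coeff p i ℤ.+ coeff (q +ₚ r) i        ≡⟨ coeff-+ p (q +ₚ r) i ⟨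
  coeff (p +ₚ (q +ₚ r)) i               ∎
  where open ≡-Reasoning

+-identityʳ : ∀ p → p +ₚ [] ≐ p
+-identityʳ p = mk≐ λ i → trans (coeff-+ p [] i) (ℤ.+-identityʳ _)

-‿inverseʳ : ∀ p → p -ₚ p ≐ []
-‿inverseʳ p = mk≐ λ i → trans (coeff-- p p i) (ℤ.+-inverseʳ (coeff p i))

-‿cong : ∀ {p q} → p ≐ q → negₚ p ≐ negₚ q
-‿cong {p} {q} e = mk≐ λ i → trans (coeff-neg p i) (trans (cong ℤ.-_ (at e i)) (sym (coeff-neg q i)))

*-zeroˡ : ∀ {p} → p ≐ [] → ∀ q → p *ₚ q ≐ []
*-zeroˡ {[]} z q = ≐-refl
*-zeroˡ {a ∷ p} z q = mk≐ λ where
  zero → trans (coeff-*-zero a p q) (trans (cong (ℤ._* coeff q 0) (at z 0)) (ℤ.*-zeroˡ (coeff q 0)))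
  (suc i) → trans (coeff-*-suc a p q i) (trans
    (cong₂ ℤ._+_ (trans (cong (ℤ._* coeff q (suc i)) (at z 0)) (ℤ.*-zeroˡ (coeff q (suc i))))
                 (at (*-zeroˡ {p} (mk≐ λ j → at z (suc j)) q) i))
    (ℤ.+-identityˡ 0ℤ))

*-congˡ : ∀ {p p'} q → p ≐ p' → p *ₚ q ≐ p' *ₚ q
*-congˡ {[]} {p'} q e = ≐-sym (*-zeroˡ (≐-sym e) q)
*-congˡ {a ∷ p} {[]} q e = *-zeroˡ e q
*-congˡ {a ∷ p} {b ∷ p'} q e = mk≐ λ where
  zero → trans (coeff-*-zero a p q) (trans (cong (ℤ._* coeff q 0) (at e 0)) (sym (coeff-*-zero b p' q)))
  (suc i) → trans (coeff-*-suc a p q i) (trans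
    (cong₂ ℤ._+_ (cong (ℤ._* coeff q (suc i)) (at e 0)) (at (*-congˡ {p} {p'} q (mk≐ λ j → at e (suc j))) i))
    (sym (coeff-*-suc b p' q i)))

*-congʳ : ∀ p {q q'} → q ≐ q' → p *ₚ q ≐ p *ₚ q'
*-congʳ [] e = ≐-refl
*-congʳ (a ∷ p) {q} {q'} e = mk≐ λ where
  zero → trans (coeff-*-zero a p q) (trans (cong (a ℤ.*_) (at e 0)) (sym (coeff-*-zero a p q')))
  (suc i) → trans (coeff-*-suc a p q i) (trans
    (cong₂ ℤ._+_ (cong (a ℤ.*_) (at e (suc i))) (at (*-congʳ p e) i))
    (sym (coeff-*-suc a p q' i)))

*-distribʳ : ∀ q p p' → (p +ₚ p') *ₚ q ≐ p *ₚ q +ₚ p' *ₚ q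
*-distribʳ q [] p' = ≐-refl
*-distribʳ q (a ∷ p) [] = ≐-sym (+-identityʳ ((a ∷ p) *ₚ q))
*-distribʳ q (a ∷ p) (b ∷ p') = mk≐ (λ where
  zero → trans (coeff-*-zero (a ℤ.+ b) (p +ₚ p') q) (trans (ℤ.*-distribʳ-+ (coeff q 0) a b)
    (sym (trans (coeff-+ ((a ∷ p) *ₚ q) ((b ∷ p') *ₚ q) 0)
                (cong₂ ℤ._+_ (coeff-*-zero a p q) (coeff-*-zero b p' q)))))
  (suc i) → trans (coeff-*-suc (a ℤ.+ b) (p +ₚ p') q i)
    (trans (cong (λ x → (a ℤ.+ b) ℤ.* coeff q (suc i) ℤ.+ x)
                 (trans (at (*-distribʳ q p p') i) (coeff-+ (p *ₚ q) (p' *ₚ q) i)))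
    (trans (interchange a b (coeff q (suc i)) (coeff (p *ₚ q) i) (coeff (p' *ₚ q) i))
    (sym (trans (coeff-+ ((a ∷ p) *ₚ q) ((b ∷ p') *ₚ q) (suc i))
                (cong₂ ℤ._+_ (coeff-*-suc a p q i) (coeff-*-suc b p' q i)))))))
  where
  interchange : ∀ a b c x y → (a ℤ.+ b) ℤ.* c ℤ.+ (x ℤ.+ y) ≡ (a ℤ.* c ℤ.+ x) ℤ.+ (b ℤ.* c ℤ.+ y)
  interchange = ℤ-solve-∀

scale-* : ∀ a p q → map (a ℤ.*_) p *ₚ q ≐ map (a ℤ.*_) (p *ₚ q)
scale-* a [] q = ≐-refl
scale-* a (b ∷ p) q = mk≐ (λ where
  zero → trans (coeff-*-zero (a ℤ.* b) (map (a ℤ.*_) p) q) (trans (ℤ.*-assoc a b (coeff q 0))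
    (sym (trans (coeff-scale a ((b ∷ p) *ₚ q) 0) (cong (a ℤ.*_) (coeff-*-zero b p q)))))
  (suc i) → trans (coeff-*-suc (a ℤ.* b) (map (a ℤ.*_) p) q i)
    (trans (cong (λ x → a ℤ.* b ℤ.* coeff q (suc i) ℤ.+ x)
                 (trans (at (scale-* a p q) i) (coeff-scale a (p *ₚ q) i)))
    (trans (factor a b (coeff q (suc i)) (coeff (p *ₚ q) i))
    (sym (trans (coeff-scale a ((b ∷ p) *ₚ q) (suc i)) (cong (a ℤ.*_) (coeff-*-suc b p q i)))))))
  where
  factor : ∀ a b c x → a ℤ.* b ℤ.* c ℤ.+ a ℤ.* x ≡ a ℤ.* (b ℤ.* c ℤ.+ x)
  factor = ℤ-solve-∀

shift-* : ∀ p q → (0ℤ ∷ p) *ₚ q ≐ 0ℤ ∷ (p *ₚ q)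
shift-* p q = mk≐ λ where
  zero → coeff-*-zero 0ℤ p q
  (suc i) → trans (coeff-*-suc 0ℤ p q i) (ℤ.+-identityˡ _)

*-zeroʳ : ∀ q → q *ₚ [] ≐ []
*-zeroʳ [] = ≐-refl
*-zeroʳ (a ∷ q) = mk≐ λ where
  zero → refl
  (suc i) → at (*-zeroʳ q) i

coeff-*-cons : ∀ a p q i → coeff ((a ∷ p) *ₚ q) i ≡ a ℤ.* coeff q i ℤ.+ coeff (0ℤ ∷ (p *ₚ q)) i
coeff-*-cons a p q zero = trans (coeff-*-zero a p q) (sym (ℤ.+-identityʳ _))
coeff-*-cons a p q (suc i) = coeff-*-suc a p q i

*-consʳ : ∀ q a p → q *ₚ (a ∷ p) ≐ map (a ℤ.*_) q +ₚ (0ℤ ∷ (q *ₚ p))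
*-consʳ [] a p = mk≐ λ where
  zero → refl
  (suc i) → refl
*-consʳ (b ∷ q) a p = mk≐ (λ where
  zero → trans (coeff-*-zero b q (a ∷ p)) (trans (ℤ.*-comm b a)
    (sym (trans (coeff-+ (map (a ℤ.*_) (b ∷ q)) (0ℤ ∷ ((b ∷ q) *ₚ p)) 0) (ℤ.+-identityʳ _))))
  (suc i) → trans (coeff-*-suc b q (a ∷ p) i)
    (trans (cong (λ x → b ℤ.* coeff p i ℤ.+ x)
                 (trans (at (*-consʳ q a p) i) (coeff-+ (map (a ℤ.*_) q) (0ℤ ∷ (q *ₚ p)) i)))
    (trans (cong (λ x → b ℤ.* coeff p i ℤ.+ (x ℤ.+ coeff (0ℤ ∷ (q *ₚ p)) i)) (coeff-scale a q i))
    (trans (swap (b ℤ.* coeff p i) (a ℤ.* coeff q i) (coeff (0ℤ ∷ (q *ₚ p)) i))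
    (sym (trans (coeff-+ (map (a ℤ.*_) (b ∷ q)) (0ℤ ∷ ((b ∷ q) *ₚ p)) (suc i))
                (cong₂ ℤ._+_ (coeff-scale a q i) (coeff-*-cons b q p i))))))))
  where
  swap : ∀ x y z → x ℤ.+ (y ℤ.+ z) ≡ y ℤ.+ (x ℤ.+ z)
  swap = ℤ-solve-∀

*-comm : ∀ p q → p *ₚ q ≐ q *ₚ p
*-comm [] q = ≐-sym (*-zeroʳ q)
*-comm (a ∷ p) q = ≐-trans (+-cong (≐-refl {map (a ℤ.*_) q}) 0∷-comm) (≐-sym (*-consʳ q a p))
  where
  0∷-comm : 0ℤ ∷ (p *ₚ q) ≐ 0ℤ ∷ (q *ₚ p)
  0∷-comm = mk≐ λ where
    zero → refl
    (suc i) → at (*-comm p q) i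

*-assoc : ∀ p q r → (p *ₚ q) *ₚ r ≐ p *ₚ (q *ₚ r)
*-assoc [] q r = ≐-refl
*-assoc (a ∷ p) q r =
  ≐-trans (*-distribʳ r (map (a ℤ.*_) q) (0ℤ ∷ (p *ₚ q)))
          (+-cong (scale-* a q r) (≐-trans (shift-* (p *ₚ q) r) 0∷-assoc))
  where
  0∷-assoc : 0ℤ ∷ ((p *ₚ q) *ₚ r) ≐ 0ℤ ∷ (p *ₚ (q *ₚ r))
  0∷-assoc = mk≐ λ where
    zero → refl
    (suc i) → at (*-assoc p q r) i

*-distribˡ : ∀ p q q' → p *ₚ (q +ₚ q') ≐ p *ₚ q +ₚ p *ₚ q'
*-distribˡ p q q' = ≐-trans (*-comm p (q +ₚ q'))
  (≐-trans (*-distribʳ p q q') (+-cong (*-comm q p) (*-comm q' p)))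

*-identityˡ : ∀ p → one *ₚ p ≐ p
*-identityˡ p = mk≐ λ i → trans (coeff-+ (map (1ℤ ℤ.*_) p) (0ℤ ∷ []) i)
  (trans (cong₂ ℤ._+_ (coeff-scale 1ℤ p i) (coeff-[0] i)) (trans (ℤ.+-identityʳ _) (ℤ.*-identityˡ _)))
  where
  coeff-[0] : ∀ i → coeff (0ℤ ∷ []) i ≡ 0ℤ
  coeff-[0] zero = refl
  coeff-[0] (suc i) = refl

ℤ[x] : CommutativeRing _ _
ℤ[x] = record
  { Carrier = Poly ; _≈_ = _≐_ ; _+_ = _+ₚ_ ; _*_ = _*ₚ_ ; -_ = negₚ ; 0# = [] ; 1# = one
  ; isCommutativeRing = record
    { isRing = record
      { +-isAbelianGroup = record
        { isGroup = record
          { isMonoid = record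
            { isSemigroup = record
              { isMagma = record
                { isEquivalence = record { refl = ≐-refl ; sym = ≐-sym ; trans = ≐-trans }
                ; ∙-cong = +-cong }
              ; assoc = +-assoc }
            ; identity = (λ p → ≐-refl) , +-identityʳ }
          ; inverse = (λ p → ≐-trans (+-comm (negₚ p) p) (-‿inverseʳ p)) , -‿inverseʳ
          ; ⁻¹-cong = -‿cong }
        ; comm = +-comm }
      ; *-cong = λ {p} {p'} {q} e f → ≐-trans (*-congˡ q e) (*-congʳ p' f)
      ; *-assoc = *-assoc
      ; *-identity = *-identityˡ , (λ p → ≐-trans (*-comm p one) (*-identityˡ p))
      ; distrib = *-distribˡ , *-distribʳ }
    ; *-comm = *-comm } }

-- With a trivial zero test the solver keeps cancelled monomials, and normal forms of equal
-- expressions need not coincide.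
[]≟_ : ∀ p → Maybe ([] ≐ p)
[]≟ [] = just ≐-refl
[]≟ (c ∷ p) with c ℤ.≟ 0ℤ | []≟ p
... | yes refl | just []≐p = just (mk≐ λ where
  zero → refl
  (suc i) → at []≐p i)
... | _ | _ = nothing

open import Tactic.RingSolver.NonReflective (fromCommutativeRing ℤ[x] []≟_)
  using (solve; _⊜_; _⊕_; _⊗_; ⊝_)

module ≐-Reasoning = Relation.Binary.Reasoning.Setoid (CommutativeRing.setoid ℤ[x])

infix 4 _∣_
_∣_ : Poly → Poly → Set
a ∣ b = Σ Poly λ r → r *ₚ a ≐ b

∣-refl : ∀ a → a ∣ a
∣-refl a = one , *-identityˡ a

∣-trans : ∀ {a b c} → a ∣ b → b ∣ c → a ∣ c
∣-trans {a} (r , e) (s , f) = s *ₚ r , ≐-trans (*-assoc s r a) (≐-trans (*-congʳ s e) f)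

∣-respʳ : ∀ {a b b'} → b ≐ b' → a ∣ b → a ∣ b'
∣-respʳ f (r , e) = r , ≐-trans e f

∣-respˡ : ∀ {a a' b} → a ≐ a' → a ∣ b → a' ∣ b
∣-respˡ f (r , e) = r , ≐-trans (*-congʳ r (≐-sym f)) e

∣-+ : ∀ {a b c} → a ∣ b → a ∣ c → a ∣ b +ₚ c
∣-+ {a} (r , e) (s , f) = r +ₚ s , ≐-trans (*-distribʳ a r s) (+-cong e f)

∣-*ˡ : ∀ {a b} c → a ∣ b → a ∣ c *ₚ b
∣-*ˡ {a} c (r , e) = c *ₚ r , ≐-trans (*-assoc c r a) (*-congʳ c e)

∣-*-self : ∀ a c → a ∣ a *ₚ c
∣-*-self a c = c , *-comm c a

∣-[] : ∀ a → a ∣ []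
∣-[] a = [] , ≐-refl

one∣ : ∀ a → one ∣ a
one∣ a = a , ≐-trans (*-comm a one) (*-identityˡ a)

∣ₚ⇒∣ : ∀ {a b} → a ∣ₚ b → a ∣ b
∣ₚ⇒∣ (r , e) = r , ≈⇒≐ e

∣⇒∣ₚ : ∀ {a b} → a ∣ b → a ∣ₚ b
∣⇒∣ₚ (r , e) = r , ≐⇒≈ e

coeff-const-* : ∀ c x i → coeff (const c *ₚ x) i ≡ c ℤ.* coeff x i
coeff-const-* c x i = trans (coeff-+ (map (c ℤ.*_) x) (0ℤ ∷ []) i)
  (trans (cong₂ ℤ._+_ (coeff-scale c x i) (coeff-[0] i)) (ℤ.+-identityʳ _))
  where
  coeff-[0] : ∀ i → coeff (0ℤ ∷ []) i ≡ 0ℤ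
  coeff-[0] zero = refl
  coeff-[0] (suc i) = refl

coeff-*-0 : ∀ p q → coeff (p *ₚ q) 0 ≡ coeff p 0 ℤ.* coeff q 0
coeff-*-0 [] q = sym (ℤ.*-zeroˡ (coeff q 0))
coeff-*-0 (a ∷ p) q = coeff-*-zero a p q

const-*-homo : ∀ a b → const (a ℤ.* b) ≐ const a *ₚ const b
const-*-homo a b = mk≐ λ where
  zero → sym (ℤ.+-identityʳ _)
  (suc i) → refl

const-*-cancelˡ : ∀ c {x y} → c ≢ 0ℤ → const c *ₚ x ≐ const c *ₚ y → x ≐ y
const-*-cancelˡ c {x} {y} c≢0 e = mk≐ λ i → ℤ.*-cancelˡ-≡ c (coeff x i) (coeff y i) {{ℤ.≢-nonZero c≢0}}
  (trans (sym (coeff-const-* c x i)) (trans (at e i) (coeff-const-* c y i)))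

infix 4 _∣ᶜ_
_∣ᶜ_ : ℤ → Poly → Set
q ∣ᶜ p = ∀ i → q ∣ℤ coeff p i

∣ℤ0 : ∀ q → q ∣ℤ 0ℤ
∣ℤ0 q = divides 0ℤ (sym (ℤ.*-zeroˡ q))

∣ᶜ-∷ : ∀ {q x p} → q ∣ℤ x → q ∣ᶜ p → q ∣ᶜ (x ∷ p)
∣ᶜ-∷ q∣x q∣p zero = q∣x
∣ᶜ-∷ q∣x q∣p (suc i) = q∣p i

infix 4 _∣ᶜ?_
_∣ᶜ?_ : ∀ q p → Dec (q ∣ᶜ p)
q ∣ᶜ? [] = yes (λ i → ∣ℤ0 q)
q ∣ᶜ? (x ∷ p) with q ℤ∣.∣? x | q ∣ᶜ? p
... | yes q∣x | yes q∣p = yes (∣ᶜ-∷ q∣x q∣p)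
... | no q∤x | _ = no (λ q∣ → q∤x (q∣ 0))
... | yes _ | no q∤p = no (λ q∣ → q∤p (λ i → q∣ (suc i)))

const∣⇒∣ᶜ : ∀ {q p} → const q ∣ p → q ∣ᶜ p
const∣⇒∣ᶜ {q} {p} (r , e) i = divides (coeff r i) (begin
  coeff p i                  ≡⟨ at e i ⟨
  coeff (r *ₚ const q) i     ≡⟨ at (*-comm r (const q)) i ⟩
  coeff (const q *ₚ r) i     ≡⟨ coeff-const-* q r i ⟩
  q ℤ.* coeff r i            ≡⟨ ℤ.*-comm q (coeff r i) ⟩
  coeff r i ℤ.* q            ∎)
  where open ≡-Reasoning

∣ᶜ⇒const∣ : ∀ {q} p → q ∣ᶜ p → const q ∣ p
∣ᶜ⇒const∣ [] q∣p = [] , ≐-refl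
∣ᶜ⇒const∣ {q} (x ∷ p) q∣p with q∣p 0 | ∣ᶜ⇒const∣ p (λ i → q∣p (suc i))
... | divides k x≡kq | r , e = k ∷ r , mk≐ λ where
  zero → trans (coeff-*-zero k r (const q)) (sym x≡kq)
  (suc i) → trans (coeff-*-suc k r (const q) i)
    (trans (cong (ℤ._+ coeff (r *ₚ const q) i) (ℤ.*-zeroʳ k)) (trans (ℤ.+-identityˡ _) (at e i)))

-- q = 0 is allowed: Gauss's lemma then says that ℤ[x] is an integral domain.
PrimeElement : ℤ → Set
PrimeElement q = ∀ x y → q ∣ℤ x ℤ.* y → q ∣ℤ x ⊎ q ∣ℤ y

module _ {q} (q-prime : PrimeElement q) where

  ∣ᶜ-*-headless : ∀ x a b → ¬ q ∣ℤ x → q ∣ᶜ (x ∷ a) *ₚ b → q ∣ᶜ b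
  ∣ᶜ-*-headless x a [] q∤x q∣ab i = ∣ℤ0 q
  ∣ᶜ-*-headless x a (y ∷ b) q∤x q∣ab
    with q-prime x y (subst (q ∣ℤ_) (coeff-*-zero x a (y ∷ b)) (q∣ab 0))
  ... | inj₁ q∣x = ⊥-elim (q∤x q∣x)
  ... | inj₂ q∣y = ∣ᶜ-∷ q∣y (∣ᶜ-*-headless x a b q∤x q∣ab')
    where
    q∣ab' : q ∣ᶜ (x ∷ a) *ₚ b
    q∣ab' i = ℤ∣.∣m+n∣m⇒∣n
      (subst (q ∣ℤ_) (trans (at (*-consʳ (x ∷ a) y b) (suc i))
                            (coeff-+ (map (y ℤ.*_) (x ∷ a)) (0ℤ ∷ ((x ∷ a) *ₚ b)) (suc i))) (q∣ab (suc i)))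
      (subst (q ∣ℤ_) (sym (coeff-scale y (x ∷ a) (suc i))) (ℤ∣.∣m⇒∣m*n (coeff a i) q∣y))

  gauss : ∀ a b → q ∣ᶜ a *ₚ b → q ∣ᶜ a ⊎ q ∣ᶜ b
  gauss [] b q∣ab = inj₁ (λ i → ∣ℤ0 q)
  gauss (x ∷ a) b q∣ab with q ℤ∣.∣? x
  ... | no q∤x = inj₂ (∣ᶜ-*-headless x a b q∤x q∣ab)
  ... | yes q∣x = Sum.map₁ (∣ᶜ-∷ q∣x) (gauss a b q∣ab')
    where
    q∣ab' : q ∣ᶜ a *ₚ b
    q∣ab' i = ℤ∣.∣m+n∣m⇒∣n (subst (q ∣ℤ_) (coeff-*-suc x a b i) (q∣ab (suc i)))
                           (ℤ∣.∣m⇒∣m*n (coeff b (suc i)) q∣x)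

  const-∣-* : ∀ a b → const q ∣ a *ₚ b → const q ∣ a ⊎ const q ∣ b
  const-∣-* a b q∣ab = Sum.map (∣ᶜ⇒const∣ a) (∣ᶜ⇒const∣ b) (gauss a b (const∣⇒∣ᶜ q∣ab))

0-primeElement : PrimeElement 0ℤ
0-primeElement x y 0∣xy = Sum.map ≡0⇒0∣ ≡0⇒0∣ (ℤ.i*j≡0⇒i≡0∨j≡0 x (ℤ∣.0∣⇒≡0 0∣xy))
  where
  ≡0⇒0∣ : ∀ {z} → z ≡ 0ℤ → 0ℤ ∣ℤ z
  ≡0⇒0∣ z≡0 = subst (0ℤ ∣ℤ_) (sym z≡0) (∣ℤ0 0ℤ)

prime⇒primeElement : ∀ {p} → Prime p → PrimeElement (+ p)
prime⇒primeElement {p} pp x y p∣xy = Sum.map ℤ∣.∣ᵤ⇒∣ ℤ∣.∣ᵤ⇒∣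
  (euclidsLemma ℤ.∣ x ∣ ℤ.∣ y ∣ pp (subst (p ℕ∣.∣_) (ℤ.abs-* x y) (ℤ∣.∣⇒∣ᵤ p∣xy)))

*-≐[] : ∀ a b → a *ₚ b ≐ [] → a ≐ [] ⊎ b ≐ []
*-≐[] a b ab≐[] = Sum.map 0∣ᶜ⇒≐[] 0∣ᶜ⇒≐[] (gauss 0-primeElement a b 0∣ab)
  where
  0∣ᶜ⇒≐[] : ∀ {p} → 0ℤ ∣ᶜ p → p ≐ []
  0∣ᶜ⇒≐[] 0∣p = mk≐ λ i → ℤ∣.0∣⇒≡0 (0∣p i)
  0∣ab : 0ℤ ∣ᶜ a *ₚ b
  0∣ab i = subst (0ℤ ∣ℤ_) (sym (at ab≐[] i)) (∣ℤ0 0ℤ)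

prime∤one : ∀ {p} → Prime p → ¬ const (+ p) ∣ one
prime∤one {p} pp p∣1 = ¬prime[1] (subst Prime (ℕ∣.∣1⇒≡1 (ℤ∣.∣⇒∣ᵤ (const∣⇒∣ᶜ p∣1 0))) pp)

DegreeBelow : Poly → ℕ → Set
DegreeBelow p n = ∀ i → n ≤ i → coeff p i ≡ 0ℤ

degreeBelow-length : ∀ p → DegreeBelow p (length p)
degreeBelow-length [] i _ = refl
degreeBelow-length (c ∷ p) (suc i) (s≤s n≤i) = degreeBelow-length p i n≤i

degreeBelow-mono : ∀ {p m n} → m ≤ n → DegreeBelow p m → DegreeBelow p n
degreeBelow-mono m≤n p<m i n≤i = p<m i (ℕ.≤-trans m≤n n≤i)

degreeBelow-pred : ∀ {p n} → coeff p n ≡ 0ℤ → DegreeBelow p (suc n) → DegreeBelow p n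
degreeBelow-pred {p} {n} pₙ≡0 p<1+n i n≤i with ℕ.m≤n⇒m<n∨m≡n n≤i
... | inj₁ n<i = p<1+n i n<i
... | inj₂ refl = pₙ≡0

Nonconstant : Poly → Set
Nonconstant h = Σ ℕ λ i → coeff h (suc i) ≢ 0ℤ

NonconstantCommonDivisor : Poly → Poly → Set
NonconstantCommonDivisor a b = Σ Poly λ h → Nonconstant h × h ∣ a × h ∣ b

NonconstantCommonDivisor-resp : ∀ {a a' b b'} → a ≐ a' → b ≐ b' →
  NonconstantCommonDivisor a b → NonconstantCommonDivisor a' b'
NonconstantCommonDivisor-resp a≐a' b≐b' (h , nc , h∣a , h∣b) = h , nc , ∣-respʳ a≐a' h∣a , ∣-respʳ b≐b' h∣b

leading : ∀ n p → DegreeBelow p n → p ≐ [] ⊎ Σ ℕ λ j → DegreeBelow p (suc j) × coeff p j ≢ 0ℤ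
leading zero p p<0 = inj₁ (mk≐ λ i → p<0 i z≤n)
leading (suc n) p p<1+n with coeff p n ℤ.≟ 0ℤ
... | no pₙ≢0 = inj₂ (n , p<1+n , pₙ≢0)
... | yes pₙ≡0 = leading n p (degreeBelow-pred {p} pₙ≡0 p<1+n)

*-leading : ∀ p q i j → DegreeBelow p (suc i) → DegreeBelow q (suc j) →
            DegreeBelow (p *ₚ q) (suc (i + j)) × coeff (p *ₚ q) (i + j) ≡ coeff p i ℤ.* coeff q j
*-leading [] q i j p<1+i q<1+j = (λ k _ → refl) , sym (ℤ.*-zeroˡ (coeff q j))
*-leading (a ∷ p) q zero j p<1 q<1+j = degree , coeff-* j
  where
  coeff-* : ∀ k → coeff ((a ∷ p) *ₚ q) k ≡ a ℤ.* coeff q k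
  coeff-* k = trans (at (*-congˡ q p≐a) k) (coeff-const-* a q k)
    where
    p≐a : a ∷ p ≐ const a
    p≐a = mk≐ λ where
      zero → refl
      (suc k) → p<1 (suc k) (s≤s z≤n)
  degree : DegreeBelow ((a ∷ p) *ₚ q) (suc j)
  degree k j<k = trans (coeff-* k) (trans (cong (a ℤ.*_) (q<1+j k j<k)) (ℤ.*-zeroʳ a))
*-leading (a ∷ p) q (suc i) j p<2+i q<1+j with *-leading p q i j (λ k i<k → p<2+i (suc k) (s≤s i<k)) q<1+j
... | pq<1+i+j , pq-top = degree , trans (coeff-*-suc a p q (i + j)) (trans
        (cong₂ ℤ._+_ (a*0 (q<1+j (suc (i + j)) (s≤s (ℕ.m≤n+m j i)))) pq-top) (ℤ.+-identityˡ _))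
  where
  a*0 : ∀ {z} → z ≡ 0ℤ → a ℤ.* z ≡ 0ℤ
  a*0 refl = ℤ.*-zeroʳ a
  degree : DegreeBelow ((a ∷ p) *ₚ q) (suc (suc i + j))
  degree (suc k) (s≤s i+j<k) = trans (coeff-*-suc a p q k) (trans
    (cong₂ ℤ._+_ (a*0 (q<1+j (suc k) (s≤s (ℕ.≤-trans (ℕ.m≤n+m j (suc i)) i+j<k)))) (pq<1+i+j k i+j<k))
    (ℤ.+-identityˡ 0ℤ))

∣nonzero-const⇒¬Nonconstant : ∀ {h c} → c ≢ 0ℤ → h ∣ const c → ¬ Nonconstant h
∣nonzero-const⇒¬Nonconstant {h} {c} c≢0 (r , rh≐c) (i , hᵢ₊₁≢0)
  with leading _ h (degreeBelow-length h)
... | inj₁ h≐[] = hᵢ₊₁≢0 (at h≐[] (suc i))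
... | inj₂ (zero , h<1 , _) = hᵢ₊₁≢0 (h<1 (suc i) (s≤s z≤n))
... | inj₂ (suc j , h<2+j , hⱼ≢0) with leading _ r (degreeBelow-length r)
...   | inj₁ r≐[] = c≢0 (trans (sym (at rh≐c 0)) (at (*-zeroˡ r≐[] h) 0))
...   | inj₂ (k , r<1+k , rₖ≢0) =
        [ rₖ≢0 , hⱼ≢0 ]′ (ℤ.i*j≡0⇒i≡0∨j≡0 (coeff r k) (trans (sym (proj₂ (*-leading r h k (suc j) r<1+k h<2+j)))
                                                              (trans (at rh≐c (k + suc j)) (const-high k j))))
  where
  const-high : ∀ k j → coeff (const c) (k + suc j) ≡ 0ℤ
  const-high k j rewrite ℕ.+-suc k j = refl

¬Nonconstant⇒≐const : ∀ h → ¬ Nonconstant h → h ≐ const (coeff h 0)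
¬Nonconstant⇒≐const h ¬nc = mk≐ λ where
  zero → refl
  (suc i) → decidable-stable (coeff h (suc i) ℤ.≟ 0ℤ) (λ hᵢ₊₁≢0 → ¬nc (i , hᵢ₊₁≢0))

shift : ℕ → Poly → Poly
shift zero b = b
shift (suc n) b = 0ℤ ∷ shift n b

coeff-shift : ∀ n b j → coeff (shift n b) (n + j) ≡ coeff b j
coeff-shift zero b j = refl
coeff-shift (suc n) b j = coeff-shift n b j

shift≐xⁿ* : ∀ n b → shift n b ≐ shift n one *ₚ b
shift≐xⁿ* zero b = ≐-sym (*-identityˡ b)
shift≐xⁿ* (suc n) b = mk≐ λ where
  zero → sym (at (shift-* (shift n one) b) 0)
  (suc i) → trans (at (shift≐xⁿ* n b) i) (sym (at (shift-* (shift n one) b) (suc i)))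

record PseudoDivision (a b : Poly) (m : ℕ) : Set where
  field
    exponent : ℕ
    quotient remainder : Poly
    remainder-degree : DegreeBelow remainder m
    identity : const (coeff b m ℤ.^ exponent) *ₚ a ≐ quotient *ₚ b +ₚ remainder

-- Each step cancels the top coefficient t of a, replacing a by lc·a − t·xⁿ·b.
pseudoDivide : ∀ {b m} → DegreeBelow b (suc m) → ∀ n a → DegreeBelow a (n + m) → PseudoDivision a b m
pseudoDivide {b} {m} b<1+m zero a a<m = record
  { exponent = 0 ; quotient = [] ; remainder = a ; remainder-degree = a<m ; identity = *-identityˡ a }
pseudoDivide {b} {m} b<1+m (suc n) a a<1+n+m = record
  { exponent = suc k
  ; quotient = q +ₚ Lᵏ *ₚ T *ₚ xⁿ
  ; remainder = r
  ; remainder-degree = r<m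
  ; identity = begin
      const (lc ℤ.^ suc k) *ₚ a                 ≈⟨ *-congˡ a (const-*-homo lc (lc ℤ.^ k)) ⟩
      (L *ₚ Lᵏ) *ₚ a                            ≈⟨ split-off L Lᵏ a T xⁿ b ⟩
      Lᵏ *ₚ (L *ₚ a +ₚ negₚ (T *ₚ (xⁿ *ₚ b))) +ₚ Lᵏ *ₚ T *ₚ xⁿ *ₚ b
        ≈⟨ +-cong (*-congʳ Lᵏ (+-cong (≐-refl {L *ₚ a}) (-‿cong (*-congʳ T (≐-sym (shift≐xⁿ* n b)))))) ≐-refl ⟩
      Lᵏ *ₚ a' +ₚ Lᵏ *ₚ T *ₚ xⁿ *ₚ b               ≈⟨ +-cong a'-identity ≐-refl ⟩
      q *ₚ b +ₚ r +ₚ Lᵏ *ₚ T *ₚ xⁿ *ₚ b          ≈⟨ regroup q b r Lᵏ T xⁿ ⟩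
      (q +ₚ Lᵏ *ₚ T *ₚ xⁿ) *ₚ b +ₚ r             ∎ }
  where
  open ≐-Reasoning
  lc = coeff b m
  t = coeff a (n + m)
  L = const lc
  T = const t
  xⁿ = shift n one
  a' = L *ₚ a -ₚ T *ₚ shift n b
  a'<n+m : DegreeBelow a' (n + m)
  a'<n+m i n+m≤i = trans (coeff-- (L *ₚ a) (T *ₚ shift n b) i)
    (trans (cong₂ ℤ._-_ (coeff-const-* lc a i) (coeff-const-* t (shift n b) i)) (top (ℕ.m≤n⇒m<n∨m≡n m≤j)))
    where
    j = i ℕ.∸ n
    n+j≡i : n + j ≡ i
    n+j≡i = ℕ.m+[n∸m]≡n (ℕ.≤-trans (ℕ.m≤m+n n m) n+m≤i)
    m≤j : m ≤ j
    m≤j = ℕ.+-cancelˡ-≤ n m j (subst (n + m ≤_) (sym n+j≡i) n+m≤i)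
    shift-bᵢ : coeff (shift n b) i ≡ coeff b j
    shift-bᵢ = trans (cong (coeff (shift n b)) (sym n+j≡i)) (coeff-shift n b j)
    top : m ℕ.< j ⊎ m ≡ j → lc ℤ.* coeff a i ℤ.- t ℤ.* coeff (shift n b) i ≡ 0ℤ
    top (inj₁ m<j) = trans (cong₂ (λ x y → lc ℤ.* x ℤ.- t ℤ.* y)
        (a<1+n+m i (subst (suc (n + m) ≤_) n+j≡i (subst (ℕ._≤ n + j) (ℕ.+-suc n m) (ℕ.+-monoʳ-≤ n m<j))))
        (trans shift-bᵢ (b<1+m j m<j)))
      (vanish lc t)
      where
      vanish : ∀ x y → x ℤ.* 0ℤ ℤ.- y ℤ.* 0ℤ ≡ 0ℤ
      vanish = ℤ-solve-∀
    top (inj₂ refl) = trans (cong₂ (λ x y → lc ℤ.* x ℤ.- t ℤ.* y) (cong (coeff a) (sym n+j≡i)) shift-bᵢ)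
      (cancel lc t)
      where
      cancel : ∀ x y → x ℤ.* y ℤ.- y ℤ.* x ≡ 0ℤ
      cancel = ℤ-solve-∀
  open PseudoDivision (pseudoDivide {b} {m} b<1+m n a' a'<n+m)
    renaming (exponent to k; quotient to q; remainder to r; remainder-degree to r<m; identity to a'-identity)
  Lᵏ = const (lc ℤ.^ k)
  split-off : ∀ L Lᵏ a T xⁿ b →
              (L *ₚ Lᵏ) *ₚ a ≐ Lᵏ *ₚ (L *ₚ a +ₚ negₚ (T *ₚ (xⁿ *ₚ b))) +ₚ Lᵏ *ₚ T *ₚ xⁿ *ₚ b
  split-off = solve 6 (λ L Lᵏ a T xⁿ b →
    (L ⊗ Lᵏ) ⊗ a ⊜ (Lᵏ ⊗ (L ⊗ a ⊕ ⊝ (T ⊗ (xⁿ ⊗ b))) ⊕ Lᵏ ⊗ T ⊗ xⁿ ⊗ b)) ≐-refl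
  regroup : ∀ q b r Lᵏ T xⁿ → q *ₚ b +ₚ r +ₚ Lᵏ *ₚ T *ₚ xⁿ *ₚ b ≐ (q +ₚ Lᵏ *ₚ T *ₚ xⁿ) *ₚ b +ₚ r
  regroup = solve 6 (λ q b r Lᵏ T xⁿ →
    (q ⊗ b ⊕ r ⊕ Lᵏ ⊗ T ⊗ xⁿ ⊗ b) ⊜ ((q ⊕ Lᵏ ⊗ T ⊗ xⁿ) ⊗ b ⊕ r)) ≐-refl

-- The two outcomes of Euclid's algorithm in ℚ[x], with denominators cleared.
CommonFactor : Poly → Poly → Set
CommonFactor a b = Σ ℤ λ N → N ≢ 0ℤ × NonconstantCommonDivisor (const N *ₚ a) (const N *ₚ b)

record ScaledBezout (a b : Poly) : Set where
  field
    u v : Poly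
    scale : ℤ
    scale≢0 : scale ≢ 0ℤ
    identity : u *ₚ a +ₚ v *ₚ b ≐ const scale

indeterminate : Poly
indeterminate = 0ℤ ∷ 1ℤ ∷ []

1*[] : ∀ {p} → p ≐ [] → one *ₚ p ≐ []
1*[] {p} p≐[] = ≐-trans (*-identityˡ p) p≐[]

^-≢0 : ∀ c k → c ≢ 0ℤ → c ℤ.^ k ≢ 0ℤ
^-≢0 c zero c≢0 ()
^-≢0 c (suc k) c≢0 cᵏ⁺¹≡0 = [ c≢0 , ^-≢0 c k c≢0 ]′ (ℤ.i*j≡0⇒i≡0∨j≡0 c cᵏ⁺¹≡0)

*-≢0 : ∀ c d → c ≢ 0ℤ → d ≢ 0ℤ → c ℤ.* d ≢ 0ℤ
*-≢0 c d c≢0 d≢0 cd≡0 = [ c≢0 , d≢0 ]′ (ℤ.i*j≡0⇒i≡0∨j≡0 c cd≡0)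

module _ {a b m} (pd : PseudoDivision a b m) where
  open PseudoDivision pd renaming (exponent to k; quotient to q; remainder to r; identity to division)
  open ≐-Reasoning

  lcᵏ : ℤ
  lcᵏ = coeff b m ℤ.^ k

  commonFactor-lift : coeff b m ≢ 0ℤ → CommonFactor b r → CommonFactor a b
  commonFactor-lift bₘ≢0 (N , N≢0 , h , nc , h∣Nb , h∣Nr) =
    N ℤ.* lcᵏ , *-≢0 N lcᵏ N≢0 (^-≢0 _ k bₘ≢0) , h , nc ,
    ∣-respʳ (begin
      q *ₚ (const N *ₚ b) +ₚ const N *ₚ r
        ≈⟨ solve 4 (λ q N b r → (q ⊗ (N ⊗ b) ⊕ N ⊗ r) ⊜ (N ⊗ (q ⊗ b ⊕ r))) ≐-refl q (const N) b r ⟩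
      const N *ₚ (q *ₚ b +ₚ r)          ≈⟨ *-congʳ (const N) (≐-sym division) ⟩
      const N *ₚ (const lcᵏ *ₚ a)        ≈⟨ *-assoc (const N) (const lcᵏ) a ⟨
      (const N *ₚ const lcᵏ) *ₚ a        ≈⟨ *-congˡ a (const-*-homo N lcᵏ) ⟨
      const (N ℤ.* lcᵏ) *ₚ a             ∎) (∣-+ (∣-*ˡ q h∣Nb) h∣Nr) ,
    ∣-respʳ (begin
      const lcᵏ *ₚ (const N *ₚ b)        ≈⟨ *-assoc (const lcᵏ) (const N) b ⟨
      (const lcᵏ *ₚ const N) *ₚ b        ≈⟨ *-congˡ b (*-comm (const lcᵏ) (const N)) ⟩
      (const N *ₚ const lcᵏ) *ₚ b        ≈⟨ *-congˡ b (const-*-homo N lcᵏ) ⟨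
      const (N ℤ.* lcᵏ) *ₚ b             ∎) (∣-*ˡ (const lcᵏ) h∣Nb)

  scaledBezout-lift : ScaledBezout b r → ScaledBezout a b
  scaledBezout-lift sb = record
    { u = v *ₚ const lcᵏ ; v = u -ₚ v *ₚ q ; scale = N ; scale≢0 = scale≢0
    ; identity = begin
        v *ₚ const lcᵏ *ₚ a +ₚ (u -ₚ v *ₚ q) *ₚ b  ≈⟨ +-cong (*-assoc v (const lcᵏ) a) ≐-refl ⟩
        v *ₚ (const lcᵏ *ₚ a) +ₚ (u -ₚ v *ₚ q) *ₚ b ≈⟨ +-cong (*-congʳ v division) ≐-refl ⟩
        v *ₚ (q *ₚ b +ₚ r) +ₚ (u -ₚ v *ₚ q) *ₚ b
          ≈⟨ solve 5 (λ v q b r u → (v ⊗ (q ⊗ b ⊕ r) ⊕ (u ⊕ ⊝ (v ⊗ q)) ⊗ b) ⊜ (u ⊗ b ⊕ v ⊗ r)) ≐-refl v q b r u ⟩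
        u *ₚ b +ₚ v *ₚ r                           ≈⟨ identity ⟩
        const N                                    ∎ }
    where open ScaledBezout sb renaming (scale to N)

euclid-[] : ∀ a {b} → b ≐ [] → CommonFactor a b ⊎ ScaledBezout a b
euclid-[] a b≐[] with leading _ a (degreeBelow-length a)
... | inj₁ a≐[] = inj₁ (1ℤ , (λ ()) , indeterminate , (0 , λ ()) ,
                       ∣-respʳ (≐-sym (1*[] a≐[])) (∣-[] indeterminate) ,
                       ∣-respʳ (≐-sym (1*[] b≐[])) (∣-[] indeterminate))
... | inj₂ (zero , a<1 , a₀≢0) = inj₂ record
  { u = one ; v = [] ; scale = coeff a 0 ; scale≢0 = a₀≢0
  ; identity = ≐-trans (+-identityʳ (one *ₚ a)) (≐-trans (*-identityˡ a) (mk≐ λ where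
      zero → refl
      (suc i) → a<1 (suc i) (s≤s z≤n))) }
... | inj₂ (suc j , _ , aⱼ₊₁≢0) = inj₁ (1ℤ , (λ ()) , a , (j , aⱼ₊₁≢0) ,
                                      ∣-respʳ (≐-sym (*-identityˡ a)) (∣-refl a) , ∣-respʳ (≐-sym (1*[] b≐[])) (∣-[] a))

euclid : ∀ m a b → DegreeBelow b m → CommonFactor a b ⊎ ScaledBezout a b
euclid zero a b b<0 = euclid-[] a (mk≐ λ i → b<0 i z≤n)
euclid (suc m) a b b<1+m with coeff b m ℤ.≟ 0ℤ
... | yes bₘ≡0 = euclid m a b (degreeBelow-pred {b} bₘ≡0 b<1+m)
... | no bₘ≢0 = Sum.map (commonFactor-lift pd bₘ≢0) (scaledBezout-lift pd)
                        (euclid m b (PseudoDivision.remainder pd) (PseudoDivision.remainder-degree pd))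
  where
  pd : PseudoDivision a b m
  pd = pseudoDivide {b} {m} b<1+m (length a) a (degreeBelow-mono {a} (ℕ.m≤m+n _ m) (degreeBelow-length a))

unit-square : ∀ k → ℤ.∣ k ∣ ≡ 1 → const k *ₚ const k ≐ one
unit-square (+ 1) _ = ≐-sym (const-*-homo 1ℤ 1ℤ)
unit-square -[1+ 0 ] _ = ≐-sym (const-*-homo -[1+ 0 ] -[1+ 0 ])
unit-square (+ 0) ()
unit-square (+ suc (suc n)) ()
unit-square -[1+ suc n ] ()

∣-unit-scale : ∀ {h N a} → ℤ.∣ N ∣ ≡ 1 → h ∣ const N *ₚ a → h ∣ a
∣-unit-scale {h} {N} {a} ∣N∣≡1 h∣Na = ∣-respʳ NNa≐a (∣-*ˡ (const N) h∣Na)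
  where
  NNa≐a : const N *ₚ (const N *ₚ a) ≐ a
  NNa≐a = ≐-trans (≐-sym (*-assoc (const N) (const N) a))
                  (≐-trans (*-congˡ a (unit-square N ∣N∣≡1)) (*-identityˡ a))

const-*-comm : ∀ c r h → r *ₚ (const c *ₚ h) ≐ const c *ₚ (r *ₚ h)
const-*-comm c = solve 3 (λ c r h → (r ⊗ (c ⊗ h)) ⊜ (c ⊗ (r ⊗ h))) ≐-refl (const c)

∣-cancel-const : ∀ {c h y} → c ≢ 0ℤ → const c *ₚ h ∣ const c *ₚ y → h ∣ y
∣-cancel-const {c} {h} c≢0 (r , e) = r , const-*-cancelˡ c c≢0 (≐-trans (≐-sym (const-*-comm c r h)) e)

const-∣? : ∀ c h → Dec (const c ∣ h)
const-∣? c h = map′ (∣ᶜ⇒const∣ h) const∣⇒∣ᶜ (c ∣ᶜ? h)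

module _ {p} (pp : Prime p) where

  +p≢0 : + p ≢ 0ℤ
  +p≢0 p≡0 = ¬prime[0] (subst Prime (cong ℤ.∣_∣ p≡0) pp)

  ∣-cancel-prime : ∀ {h y} → ¬ const (+ p) ∣ h → h ∣ const (+ p) *ₚ y → h ∣ y
  ∣-cancel-prime {h} {y} p∤h (r , rh≐py)
    with const-∣-* (prime⇒primeElement pp) r h (y , ≐-trans (*-comm y (const (+ p))) (≐-sym rh≐py))
  ... | inj₂ p∣h = ⊥-elim (p∤h p∣h)
  ... | inj₁ (s , sp≐r) =
    ∣-cancel-const +p≢0 (s , ≐-trans (≐-sym (*-assoc s (const (+ p)) h)) (≐-trans (*-congˡ h sp≐r) rh≐py))

  NonconstantCommonDivisor-unscale-prime : ∀ {y z} →
    NonconstantCommonDivisor (const (+ p) *ₚ y) (const (+ p) *ₚ z) → NonconstantCommonDivisor y z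
  NonconstantCommonDivisor-unscale-prime (h , (i , hᵢ₊₁≢0) , h∣py , h∣pz) with const-∣? (+ p) h
  ... | no p∤h = h , (i , hᵢ₊₁≢0) , ∣-cancel-prime p∤h h∣py , ∣-cancel-prime p∤h h∣pz
  ... | yes (s , sp≐h) =
    s , (i , sᵢ₊₁≢0) , ∣-cancel-const +p≢0 (∣-respˡ h≐ps h∣py) , ∣-cancel-const +p≢0 (∣-respˡ h≐ps h∣pz)
    where
    h≐ps : h ≐ const (+ p) *ₚ s
    h≐ps = ≐-trans (≐-sym sp≐h) (*-comm s (const (+ p)))
    sᵢ₊₁≢0 : coeff s (suc i) ≢ 0ℤ
    sᵢ₊₁≢0 sᵢ₊₁≡0 = hᵢ₊₁≢0 (trans (at h≐ps (suc i)) (trans (coeff-const-* (+ p) s (suc i))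
                                   (trans (cong (+ p ℤ.*_) sᵢ₊₁≡0) (ℤ.*-zeroʳ (+ p)))))

-- A prime factor p of N either divides every coefficient of h, and is divided out of h,
-- or cancels from h ∣ p·y by Gauss's lemma.
NonconstantCommonDivisor-unscale : ∀ {N y z} → N ≢ 0ℤ →
  NonconstantCommonDivisor (const N *ₚ y) (const N *ₚ z) → NonconstantCommonDivisor y z
NonconstantCommonDivisor-unscale {N} N≢0 = go (factors fact) (factorsPrime fact) N (isFactorisation fact)
  where
  open PrimeFactorisation using (factors; factorsPrime; isFactorisation)
  fact = factorise ℤ.∣ N ∣ {{ℤ.≢-nonZero N≢0}}
  go : ∀ fs → All Prime fs → ∀ N {y z} → ℤ.∣ N ∣ ≡ product fs →
       NonconstantCommonDivisor (const N *ₚ y) (const N *ₚ z) → NonconstantCommonDivisor y z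
  go [] [] N ∣N∣≡1 (h , nc , h∣Ny , h∣Nz) =
    h , nc , ∣-unit-scale {N = N} ∣N∣≡1 h∣Ny , ∣-unit-scale {N = N} ∣N∣≡1 h∣Nz
  go (p ∷ fs) (pp ∷ ps) N {y} {z} ∣N∣≡p·fs ncd
    with ℤ∣.∣ᵤ⇒∣ {+ p} {N} (ℕ∣.divides (product fs) (trans ∣N∣≡p·fs (ℕ.*-comm p _)))
  ... | divides K N≡Kp = go fs ps K ∣K∣≡fs
        (NonconstantCommonDivisor-unscale-prime pp (NonconstantCommonDivisor-resp (N*≐p*K* y) (N*≐p*K* z) ncd))
    where
    instance _ = prime⇒nonZero pp
    ∣K∣≡fs : ℤ.∣ K ∣ ≡ product fs
    ∣K∣≡fs = ℕ.*-cancelʳ-≡ ℤ.∣ K ∣ (product fs) p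
      (trans (sym (ℤ.abs-* K (+ p))) (trans (cong ℤ.∣_∣ (sym N≡Kp)) (trans ∣N∣≡p·fs (ℕ.*-comm p _))))
    N*≐p*K* : ∀ w → const N *ₚ w ≐ const (+ p) *ₚ (const K *ₚ w)
    N*≐p*K* w = begin
      const N *ₚ w                   ≡⟨ cong (λ n → const n *ₚ w) N≡Kp ⟩
      const (K ℤ.* + p) *ₚ w         ≈⟨ *-congˡ w (const-*-homo K (+ p)) ⟩
      (const K *ₚ const (+ p)) *ₚ w
        ≈⟨ solve 3 (λ K P w → ((K ⊗ P) ⊗ w) ⊜ (P ⊗ (K ⊗ w))) ≐-refl (const K) (const (+ p)) w ⟩
      const (+ p) *ₚ (const K *ₚ w)  ∎
      where open ≐-Reasoning

Coprime : Poly → Poly → Set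
Coprime a b = ∀ c → c ∣ a → c ∣ b → c ∣ one

coprime⇒scaledBezout : ∀ {a b} → Coprime a b → ScaledBezout a b
coprime⇒scaledBezout {a} {b} cop with euclid _ a b (degreeBelow-length b)
... | inj₂ sb = sb
... | inj₁ (N , N≢0 , ncd) with NonconstantCommonDivisor-unscale N≢0 ncd
...   | h , nc , h∣a , h∣b = ⊥-elim (∣nonzero-const⇒¬Nonconstant (λ ()) (cop h h∣a h∣b) nc)

∣nonzero-const⇒unit∨prime : ∀ {h N} → N ≢ 0ℤ → h ∣ const N →
  h ∣ one ⊎ Σ ℕ λ p → Prime p × const (+ p) ∣ h
∣nonzero-const⇒unit∨prime {h} {N} N≢0 h∣N@(r , rh≐N) = classify (factorise ℤ.∣ k ∣ {{ℤ.≢-nonZero k≢0}})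
  where
  k = coeff h 0
  h≐k : h ≐ const k
  h≐k = ¬Nonconstant⇒≐const h (∣nonzero-const⇒¬Nonconstant N≢0 h∣N)
  k≢0 : k ≢ 0ℤ
  k≢0 k≡0 = N≢0 (begin
    N                       ≡⟨ at rh≐N 0 ⟨
    coeff (r *ₚ h) 0        ≡⟨ coeff-*-0 r h ⟩
    coeff r 0 ℤ.* k         ≡⟨ cong (coeff r 0 ℤ.*_) k≡0 ⟩
    coeff r 0 ℤ.* 0ℤ        ≡⟨ ℤ.*-zeroʳ (coeff r 0) ⟩
    0ℤ                      ∎)
    where open ≡-Reasoning
  classify : PrimeFactorisation ℤ.∣ k ∣ → h ∣ one ⊎ Σ ℕ λ p → Prime p × const (+ p) ∣ h
  classify record { factors = [] ; isFactorisation = ∣k∣≡1 } =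
    inj₁ (const k , ≐-trans (*-congʳ (const k) h≐k) (unit-square k ∣k∣≡1))
  classify record { factors = p ∷ fs ; isFactorisation = ∣k∣≡p·fs ; factorsPrime = pp ∷ _ } =
    inj₂ (p , pp , ∣-respʳ (≐-sym h≐k) (∣ᶜ⇒const∣ (const k) (∣ᶜ-∷ p∣k λ i → ∣ℤ0 (+ p))))
    where
    p∣k : + p ∣ℤ k
    p∣k = ℤ∣.∣ᵤ⇒∣ (ℕ∣.divides (product fs) (trans ∣k∣≡p·fs (ℕ.*-comm p _)))

-- By the product of the two Bezout identities h divides a nonzero constant; a prime factor
-- of that constant would divide a and, by Gauss's lemma, b or c.
coprime-*ʳ : ∀ {a b c} → Coprime a b → Coprime a c → Coprime a (b *ₚ c)
coprime-*ʳ {a} {b} {c} cop-ab cop-ac h h∣a h∣bc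
  with ∣nonzero-const⇒unit∨prime (*-≢0 N N' scale≢0 scale≢0')
                                  (∣-respʳ bezout-product (∣-+ (∣-*ˡ w h∣a) (∣-*ˡ (v *ₚ v') h∣bc)))
  where
  open ScaledBezout (coprime⇒scaledBezout cop-ab) renaming (scale to N)
  open ScaledBezout (coprime⇒scaledBezout cop-ac)
    renaming (u to u'; v to v'; scale to N'; scale≢0 to scale≢0'; identity to identity')
  w = u *ₚ u' *ₚ a +ₚ u *ₚ v' *ₚ c +ₚ v *ₚ b *ₚ u'
  open ≐-Reasoning
  bezout-product : w *ₚ a +ₚ (v *ₚ v') *ₚ (b *ₚ c) ≐ const (N ℤ.* N')
  bezout-product = begin
    w *ₚ a +ₚ (v *ₚ v') *ₚ (b *ₚ c)              ≈⟨ solve 7 (λ u u' a v' c v b →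
        ((u ⊗ u' ⊗ a ⊕ u ⊗ v' ⊗ c ⊕ v ⊗ b ⊗ u') ⊗ a ⊕ (v ⊗ v') ⊗ (b ⊗ c)) ⊜ ((u ⊗ a ⊕ v ⊗ b) ⊗ (u' ⊗ a ⊕ v' ⊗ c)))
        ≐-refl u u' a v' c v b ⟩
    (u *ₚ a +ₚ v *ₚ b) *ₚ (u' *ₚ a +ₚ v' *ₚ c)   ≈⟨ *-congˡ _ identity ⟩
    const N *ₚ (u' *ₚ a +ₚ v' *ₚ c)              ≈⟨ *-congʳ (const N) identity' ⟩
    const N *ₚ const N'                          ≈⟨ const-*-homo N N' ⟨
    const (N ℤ.* N')                             ∎
... | inj₁ h∣1 = h∣1
... | inj₂ (p , pp , p∣h) = ⊥-elim ([ prime∤one pp ∘ cop-ab _ p∣a , prime∤one pp ∘ cop-ac _ p∣a ]′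
                                     (const-∣-* (prime⇒primeElement pp) b c (∣-trans p∣h h∣bc)))
  where
  p∣a = ∣-trans p∣h h∣a

*-cancelʳ-≐ : ∀ y z c → y *ₚ c ≐ z *ₚ c → y ≐ z ⊎ c ≐ []
*-cancelʳ-≐ y z c yc≐zc = Sum.map₁ y-z≐[]⇒y≐z (*-≐[] (y -ₚ z) c (begin
  (y -ₚ z) *ₚ c            ≈⟨ solve 3 (λ y z c → ((y ⊕ ⊝ z) ⊗ c) ⊜ (y ⊗ c ⊕ ⊝ (z ⊗ c))) ≐-refl y z c ⟩
  y *ₚ c -ₚ z *ₚ c         ≈⟨ +-cong yc≐zc ≐-refl ⟩
  z *ₚ c -ₚ z *ₚ c         ≈⟨ -‿inverseʳ (z *ₚ c) ⟩
  []                       ∎))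
  where
  open ≐-Reasoning
  y-z≐[]⇒y≐z : y -ₚ z ≐ [] → y ≐ z
  y-z≐[]⇒y≐z y-z≐[] = begin
    y                  ≈⟨ solve 2 (λ y z → y ⊜ ((y ⊕ ⊝ z) ⊕ z)) ≐-refl y z ⟩
    (y -ₚ z) +ₚ z      ≈⟨ +-cong y-z≐[] ≐-refl ⟩
    z                  ∎

-- gcd(p·a, a·H) = a·gcd(p, H) = a when p ∤ H; Gauss's lemma replaces unique factorisation.
∣p*a⇒∣a*H⇒∣a : ∀ {p} → Prime p → ∀ {c a H} → ¬ const (+ p) ∣ H →
                c ∣ const (+ p) *ₚ a → c ∣ a *ₚ H → c ∣ a
∣p*a⇒∣a*H⇒∣a {p} pp {c} {a} {H} p∤H (r , rc≐Pa) (s , sc≐aH) = by-cases (const-∣? (+ p) r)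
  where
  open ≐-Reasoning
  P = const (+ p)

  via-p∣r : P ∣ r → c ∣ a
  via-p∣r (t , tP≐r) = t , const-*-cancelˡ (+ p) (+p≢0 pp) (begin
    P *ₚ (t *ₚ c)     ≈⟨ solve 3 (λ P t c → (P ⊗ (t ⊗ c)) ⊜ ((t ⊗ P) ⊗ c)) ≐-refl P t c ⟩
    (t *ₚ P) *ₚ c     ≈⟨ *-congˡ c tP≐r ⟩
    r *ₚ c            ≈⟨ rc≐Pa ⟩
    P *ₚ a            ∎)

  via-p∣c : ¬ P ∣ r → P ∣ c → c ∣ a
  via-p∣c p∤r (c' , c'P≐c) = [ ⊥-elim ∘ p∤rH , c'≐[]⇒c∣a ]′ (*-cancelʳ-≐ (P *ₚ s) (r *ₚ H) c' Psc'≐rHc')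
    where
    rc'≐a : r *ₚ c' ≐ a
    rc'≐a = const-*-cancelˡ (+ p) (+p≢0 pp) (begin
      P *ₚ (r *ₚ c')     ≈⟨ solve 3 (λ P r c' → (P ⊗ (r ⊗ c')) ⊜ (r ⊗ (c' ⊗ P))) ≐-refl P r c' ⟩
      r *ₚ (c' *ₚ P)     ≈⟨ *-congʳ r c'P≐c ⟩
      r *ₚ c             ≈⟨ rc≐Pa ⟩
      P *ₚ a             ∎)
    Psc'≐rHc' : (P *ₚ s) *ₚ c' ≐ (r *ₚ H) *ₚ c'
    Psc'≐rHc' = begin
      (P *ₚ s) *ₚ c'     ≈⟨ solve 3 (λ P s c' → ((P ⊗ s) ⊗ c') ⊜ (s ⊗ (c' ⊗ P))) ≐-refl P s c' ⟩
      s *ₚ (c' *ₚ P)     ≈⟨ *-congʳ s c'P≐c ⟩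
      s *ₚ c             ≈⟨ sc≐aH ⟩
      a *ₚ H             ≈⟨ *-congˡ H rc'≐a ⟨
      (r *ₚ c') *ₚ H     ≈⟨ solve 3 (λ r c' H → ((r ⊗ c') ⊗ H) ⊜ ((r ⊗ H) ⊗ c')) ≐-refl r c' H ⟩
      (r *ₚ H) *ₚ c'     ∎
    p∤rH : ¬ P *ₚ s ≐ r *ₚ H
    p∤rH Ps≐rH = [ p∤r , p∤H ]′ (const-∣-* (prime⇒primeElement pp) r H (s , ≐-trans (*-comm s P) Ps≐rH))
    c'≐[]⇒c∣a : c' ≐ [] → c ∣ a
    c'≐[]⇒c∣a c'≐[] = [] , ≐-trans (≐-sym (*-zeroˡ c'≐[] r)) (≐-trans (*-comm c' r) rc'≐a)

  by-cases : Dec (P ∣ r) → c ∣ a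
  by-cases (yes p∣r) = via-p∣r p∣r
  by-cases (no p∤r) = [ ⊥-elim ∘ p∤r , via-p∣c p∤r ]′
    (const-∣-* (prime⇒primeElement pp) r c (a , ≐-trans (*-comm a P) (≐-sym rc≐Pa)))

mkIsGCD : ∀ {h a b} → h ∣ a → h ∣ b → (∀ c → c ∣ a → c ∣ b → c ∣ h) → IsGCD h a b
mkIsGCD h∣a h∣b greatest =
  ∣⇒∣ₚ h∣a , ∣⇒∣ₚ h∣b , λ c c∣a c∣b → ∣⇒∣ₚ (greatest c (∣ₚ⇒∣ c∣a) (∣ₚ⇒∣ c∣b))

Coprime⇒IsGCD-one : ∀ {a b} → Coprime a b → IsGCD one a b
Coprime⇒IsGCD-one {a} {b} = mkIsGCD (one∣ a) (one∣ b)

IsGCD-one⇒Coprime : ∀ {a b} → IsGCD one a b → Coprime a b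
IsGCD-one⇒Coprime (_ , _ , greatest) c c∣a c∣b = ∣ₚ⇒∣ (greatest c (∣⇒∣ₚ c∣a) (∣⇒∣ₚ c∣b))

coprime-sym : ∀ {a b} → Coprime a b → Coprime b a
coprime-sym cop c c∣b c∣a = cop c c∣a c∣b

coprime-∣ʳ : ∀ {a b c} → Coprime a b → c ∣ b → Coprime a c
coprime-∣ʳ cop c∣b h h∣a h∣c = cop h h∣a (∣-trans h∣c c∣b)

∣-+-cancelˡ : ∀ {c u w} → c ∣ u +ₚ w → c ∣ u → c ∣ w
∣-+-cancelˡ {c} {u} {w} (r , rc≐u+w) (s , sc≐u) = r -ₚ s , (begin
  (r -ₚ s) *ₚ c           ≈⟨ solve 3 (λ r s c → ((r ⊕ ⊝ s) ⊗ c) ⊜ (r ⊗ c ⊕ ⊝ (s ⊗ c))) ≐-refl r s c ⟩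
  r *ₚ c -ₚ s *ₚ c        ≈⟨ +-cong rc≐u+w (-‿cong sc≐u) ⟩
  (u +ₚ w) -ₚ u           ≈⟨ solve 2 (λ u w → ((u ⊕ w) ⊕ ⊝ u) ⊜ w) ≐-refl u w ⟩
  w                       ∎)
  where open ≐-Reasoning

coprime-respʳ : ∀ {a b b'} → b ≐ b' → Coprime a b → Coprime a b'
coprime-respʳ b≐b' cop c c∣a c∣b' = cop c c∣a (∣-respʳ (≐-sym b≐b') c∣b')

coprime-*+ : ∀ {a b} y → Coprime a b → Coprime a (a *ₚ y +ₚ b)
coprime-*+ {a} y cop c c∣a c∣ay+b = cop c c∣a (∣-+-cancelˡ c∣ay+b (∣-trans c∣a (∣-*-self a y)))

module GFP (p0 : ℤ) (p1 d g : Poly) where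

  term : ℕ → Poly
  term = G p0 p1 d g

  induction-by-2 : (P : Poly → Set) → (∀ y x → P x → P (d *ₚ y +ₚ g *ₚ x)) →
                   ∀ k → P (term k) → ∀ n → P (term (2 * n + k))
  induction-by-2 P step k Pₖ zero = Pₖ
  induction-by-2 P step k Pₖ (suc n) = subst (P ∘ term) (sym 2+2n+k)
    (step (term (suc (2 * n + k))) (term (2 * n + k)) (induction-by-2 P step k Pₖ n))
    where
    2+2n+k : 2 * suc n + k ≡ 2 + (2 * n + k)
    2+2n+k = trans (cong (_+ k) (ℕ.*-suc 2 n)) (ℕ.+-assoc 2 (2 * n) k)

  module _ (cop-dg : Coprime d g) where

    coprime-d-by-2 : ∀ k → Coprime d (term k) → ∀ n → Coprime d (term (2 * n + k))
    coprime-d-by-2 = induction-by-2 (Coprime d) λ y x cop-dx → coprime-*+ y (coprime-*ʳ cop-dg cop-dx)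

    coprime-g : Coprime g p1 → ∀ n → Coprime g (term (suc n))
    coprime-g cop-g1 zero = cop-g1
    coprime-g cop-g1 (suc n) = coprime-respʳ (+-comm (g *ₚ term n) (d *ₚ term (suc n)))
      (coprime-*+ (term n) (coprime-*ʳ (coprime-sym cop-dg) (coprime-g cop-g1 n)))

  d∣-by-2 : ∀ k → d ∣ term k → ∀ n → d ∣ term (2 * n + k)
  d∣-by-2 = induction-by-2 (d ∣_) λ y x d∣x → ∣-+ (∣-*-self d y) (∣-*ˡ g d∣x)

  coprime-d-p1⇒odd-gcd : Coprime d g → p1 ≐ one → ∀ n → IsGCD p1 d (term (2 * n + 1))
  coprime-d-p1⇒odd-gcd cop-dg p1≐1 n = mkIsGCD (∣-respˡ (≐-sym p1≐1) (one∣ d)) (∣-respˡ (≐-sym p1≐1) (one∣ _))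
    λ c c∣d c∣t → ∣-respʳ (≐-sym p1≐1) (coprime-d-by-2 cop-dg 1 cop-d-p1 n c c∣d c∣t)
    where
    cop-d-p1 : Coprime d p1
    cop-d-p1 c _ c∣p1 = ∣-respʳ p1≐1 c∣p1

  associated⇒odd-gcd : d ∣ p1 → p1 ∣ d → ∀ n → IsGCD p1 d (term (2 * n + 1))
  associated⇒odd-gcd d∣p1 p1∣d n = mkIsGCD p1∣d (∣-trans p1∣d (d∣-by-2 1 d∣p1 n)) λ c c∣d _ → ∣-trans c∣d d∣p1

  module _ (cop-dg : Coprime d g) (d≐2p0p1 : d ≐ const (+ 2) *ₚ (const p0 *ₚ p1)) where

    OddMultiple : Poly → Set
    OddMultiple x = Σ Poly λ H → x ≐ p1 *ₚ H × ¬ const (+ 2) ∣ H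

    2∣d : const (+ 2) ∣ d
    2∣d = const p0 *ₚ p1 , ≐-trans (*-comm (const p0 *ₚ p1) (const (+ 2))) (≐-sym d≐2p0p1)

    p1∣2p0p1 : p1 ∣ d
    p1∣2p0p1 = const (+ 2) *ₚ const p0 , ≐-trans (*-assoc (const (+ 2)) (const p0) p1) (≐-sym d≐2p0p1)

    2∤g : ¬ const (+ 2) ∣ g
    2∤g 2∣g = prime∤one prime[2] (cop-dg _ 2∣d 2∣g)

    oddMultiple-by-2 : ∀ n → OddMultiple (term (2 * n + 1))
    oddMultiple-by-2 = induction-by-2 OddMultiple step 1
      (one , ≐-sym (≐-trans (*-comm p1 one) (*-identityˡ p1)) , prime∤one prime[2])
      where
      T = const (+ 2)
      P₀ = const p0
      step : ∀ y x → OddMultiple x → OddMultiple (d *ₚ y +ₚ g *ₚ x)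
      step y x (H , x≐p1H , 2∤H) = T *ₚ (P₀ *ₚ y) +ₚ g *ₚ H , (begin
          d *ₚ y +ₚ g *ₚ x                          ≈⟨ +-cong (*-congˡ y d≐2p0p1) (*-congʳ g x≐p1H) ⟩
          (T *ₚ (P₀ *ₚ p1)) *ₚ y +ₚ g *ₚ (p1 *ₚ H)  ≈⟨ solve 6 (λ T P₀ p1 y g H →
            ((T ⊗ (P₀ ⊗ p1)) ⊗ y ⊕ g ⊗ (p1 ⊗ H)) ⊜ (p1 ⊗ (T ⊗ (P₀ ⊗ y) ⊕ g ⊗ H))) ≐-refl T P₀ p1 y g H ⟩
          p1 *ₚ (T *ₚ (P₀ *ₚ y) +ₚ g *ₚ H)         ∎) ,
        λ 2∣ → [ 2∤g , 2∤H ]′ (const-∣-* (prime⇒primeElement prime[2]) g H (∣-+-cancelˡ 2∣ (∣-*-self T (P₀ *ₚ y))))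
        where open ≐-Reasoning

    halved-p0⇒odd-gcd : const (+ 2) *ₚ p1 ≐ const p0 *ₚ d → ∀ n → IsGCD p1 d (term (2 * n + 1))
    halved-p0⇒odd-gcd 2p1≐p0d n with oddMultiple-by-2 n
    ... | H , t≐p1H , 2∤H = mkIsGCD p1∣2p0p1 (H , ≐-trans (*-comm H p1) (≐-sym t≐p1H))
      λ c c∣d c∣t → ∣p*a⇒∣a*H⇒∣a prime[2] 2∤H (∣-respʳ (≐-sym 2p1≐p0d) (∣-*ˡ (const p0) c∣d))
                                               (∣-respʳ t≐p1H c∣t)

  coprime-d-p0⇒even-gcd : Coprime d g → Coprime d (const p0) → ∀ n → IsGCD one d (term (2 * n))
  coprime-d-p0⇒even-gcd cop-dg cop-dp0 n = subst (IsGCD one d ∘ term) (ℕ.+-identityʳ (2 * n))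
    (Coprime⇒IsGCD-one (coprime-d-by-2 cop-dg 0 cop-dp0 n))

  p0≡0⇒even-gcd : p0 ≡ 0ℤ → ∀ n → IsGCD d d (term (2 * n))
  p0≡0⇒even-gcd refl n = subst (IsGCD d d ∘ term) (ℕ.+-identityʳ (2 * n))
    (mkIsGCD (∣-refl d) (d∣-by-2 0 (∣-respʳ (≐-sym const0≐[]) (∣-[] d)) n) λ c c∣d _ → c∣d)
    where
    const0≐[] : const 0ℤ ≐ []
    const0≐[] = mk≐ λ where
      zero → refl
      (suc i) → refl

  g-gcd : Coprime d g → p1 ∣ d → ∀ n → IsGCD one g (term (suc n)) × IsGCD one g p1
  g-gcd cop-dg p1∣d n = Coprime⇒IsGCD-one (coprime-g cop-dg cop-g1 n) , Coprime⇒IsGCD-one cop-g1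
    where
    cop-g1 : Coprime g p1
    cop-g1 = coprime-∣ʳ (coprime-sym cop-dg) p1∣d

lucas-∣p0∣≡1 : ∀ p0 {p1 d} → ℤ.∣ p0 ∣ ≡ 1 → const (+ 2) *ₚ p1 ≐ const p0 *ₚ d →
               d ≐ const (+ 2) *ₚ (const p0 *ₚ p1)
lucas-∣p0∣≡1 p0 {p1} {d} ∣p0∣≡1 2p1≐p0d = begin
  d                                ≈⟨ *-identityˡ d ⟨
  one *ₚ d                         ≈⟨ *-congˡ d (unit-square p0 ∣p0∣≡1) ⟨
  (const p0 *ₚ const p0) *ₚ d      ≈⟨ *-assoc (const p0) (const p0) d ⟩
  const p0 *ₚ (const p0 *ₚ d)      ≈⟨ *-congʳ (const p0) 2p1≐p0d ⟨
  const p0 *ₚ (const (+ 2) *ₚ p1)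
    ≈⟨ solve 3 (λ P₀ T p1 → (P₀ ⊗ (T ⊗ p1)) ⊜ (T ⊗ (P₀ ⊗ p1))) ≐-refl (const p0) (const (+ 2)) p1 ⟩
  const (+ 2) *ₚ (const p0 *ₚ p1)  ∎
  where open ≐-Reasoning

lucas-∣p0∣≡2 : ∀ p0 {p1 d} → ℤ.∣ p0 ∣ ≡ 2 → const (+ 2) *ₚ p1 ≐ const p0 *ₚ d → d ∣ p1 × p1 ∣ d
lucas-∣p0∣≡2 (+ 2) {p1} {d} _ 2p1≐2d =
  (one , ≐-trans (*-identityˡ d) (≐-sym p1≐d)) , (one , ≐-trans (*-identityˡ p1) p1≐d)
  where
  p1≐d : p1 ≐ d
  p1≐d = const-*-cancelˡ (+ 2) (λ ()) 2p1≐2d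
lucas-∣p0∣≡2 -[1+ 1 ] {p1} {d} _ 2p1≐-2d = (ε , ≐-sym p1≐εd) , (ε , εp1≐d)
  where
  ε : Poly
  ε = const -[1+ 0 ]
  p1≐εd : p1 ≐ ε *ₚ d
  p1≐εd = const-*-cancelˡ (+ 2) (λ ())
    (≐-trans 2p1≐-2d (≐-trans (*-congˡ d (const-*-homo (+ 2) -[1+ 0 ])) (*-assoc (const (+ 2)) ε d)))
  εp1≐d : ε *ₚ p1 ≐ d
  εp1≐d = ≐-trans (*-congʳ ε p1≐εd) (≐-trans (≐-sym (*-assoc ε ε d))
            (≐-trans (*-congˡ d (unit-square -[1+ 0 ] refl)) (*-identityˡ d)))
lucas-∣p0∣≡2 (+ 0) ()
lucas-∣p0∣≡2 (+ 1) ()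
lucas-∣p0∣≡2 (+ suc (suc (suc n))) ()
lucas-∣p0∣≡2 -[1+ 0 ] ()
lucas-∣p0∣≡2 -[1+ suc (suc n) ] ()

lemma2 : (p0 : ℤ) (p1 d g : Poly) → IsGFP p0 p1 d g
    → LucasType p0 p1 d g ⊎ FibonacciType p0 p1
    → (∀ (n : ℕ) → 1 ≤ n → IsGCD p1 d (G p0 p1 d g (2 * n + 1)))
      × (LucasType p0 p1 d g → ∀ (n : ℕ) → 1 ≤ n → IsGCD one d (G p0 p1 d g (2 * n)))
      × (FibonacciType p0 p1 → ∀ (n : ℕ) → 1 ≤ n → IsGCD d d (G p0 p1 d g (2 * n)))
      × (∀ (n : ℕ) → 1 ≤ n → IsGCD one g (G p0 p1 d g n) × IsGCD one g p1)
lemma2 p0 p1 d g (_ , _ , _ , gcd-dg , _) type =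
  (λ n _ → odd-gcd type n) ,
  (λ { (_ , _ , _ , _ , gcd-p0d , _) n _ →
        coprime-d-p0⇒even-gcd cop-dg (coprime-sym (IsGCD-one⇒Coprime gcd-p0d)) n }) ,
  (λ { (p0≡0 , _) n _ → p0≡0⇒even-gcd p0≡0 n }) ,
  λ { (suc n) _ → g-gcd cop-dg (p1∣d type) n }
  where
  open GFP p0 p1 d g
  cop-dg : Coprime d g
  cop-dg = IsGCD-one⇒Coprime gcd-dg

  p1∣d : LucasType p0 p1 d g ⊎ FibonacciType p0 p1 → p1 ∣ d
  p1∣d (inj₁ (_ , 2p1≈p0d , inj₁ ∣p0∣≡1 , _)) = p1∣2p0p1 cop-dg (lucas-∣p0∣≡1 p0 ∣p0∣≡1 (≈⇒≐ 2p1≈p0d))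
  p1∣d (inj₁ (_ , 2p1≈p0d , inj₂ ∣p0∣≡2 , _)) = proj₂ (lucas-∣p0∣≡2 p0 ∣p0∣≡2 (≈⇒≐ 2p1≈p0d))
  p1∣d (inj₂ (_ , p1≈1)) = ∣-respˡ (≐-sym (≈⇒≐ p1≈1)) (one∣ d)

  odd-gcd : LucasType p0 p1 d g ⊎ FibonacciType p0 p1 → ∀ n → IsGCD p1 d (term (2 * n + 1))
  odd-gcd (inj₁ (_ , 2p1≈p0d , inj₁ ∣p0∣≡1 , _)) =
    halved-p0⇒odd-gcd cop-dg (lucas-∣p0∣≡1 p0 ∣p0∣≡1 (≈⇒≐ 2p1≈p0d)) (≈⇒≐ 2p1≈p0d)
  odd-gcd (inj₁ (_ , 2p1≈p0d , inj₂ ∣p0∣≡2 , _)) =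
    uncurry associated⇒odd-gcd (lucas-∣p0∣≡2 p0 ∣p0∣≡2 (≈⇒≐ 2p1≈p0d))
  odd-gcd (inj₂ (_ , p1≈1)) = coprime-d-p1⇒odd-gcd cop-dg (≈⇒≐ p1≈1)
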